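{- Let $n,k$ be positive integers with $n\ge 2k$ and $\gcd(n,k)=1$. Then for every $X,Y\in V(Q(n,k))$ there is a unique $t\in\{0,1,\dots,n-1\}$ such that $\rho^t(X)=Y$.
   Context: For a positive integer $n$ let $[n]=\{1,\dots,n\}$ and let $C_n$ be the cycle on $[n]$ with edges $\{i,i+1\}$ ($1\le i\le n-1$) and $\{n,1\}$. The Schrijver graph $\mathrm{SG}(n,k)$ ($n\ge 2k$) has as vertices the $k$-subsets of $[n]$ containing no two cyclically consecutive elements, two vertices adjacent iff they are disjoint. An arc of $C_n$ is a set $\{i,i+1,\dots,i+m-1\}$ (addition mod $n$) with $1\le m\le n-1$. A set $U\subseteq[n]$ is well-spread if for any two arcs $A,B$ with $|A|=|B|$ we have $\big||A\cap U|-|B\cap U|\big|\le 1$. $Q(n,k)$ is the induced subgraph of $\mathrm{SG}(n,k)$ on all well-spread $k$-subsets of $[n]$. $\rho:[n]\to[n]$ is the rotation $i\mapsto i+1$ (mod $n$), acting on subsets elementwise. -}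

module Defs where

open import Data.Nat using (ℕ; zero; suc; _+_; _*_; _∸_; _≤_; _<_; ∣_-_∣)
open import Data.Nat.DivMod using (_mod_)
open import Data.Bool using (Bool; true; false; _∧_; if_then_else_)
open import Data.Fin using (Fin; toℕ)
open import Data.Fin.Subset using (Subset; ∣_∣)
open import Data.Vec using (lookup; tabulate)
open import Data.List using (upTo; map)
open import Data.Nat.ListAction using (sum)
open import Data.Product using (_×_)
open import Relation.Binary.PropositionalEquality using (_≡_)

-- The ground set [n] = {1,…,n} is modelled by Fin n = {0,…,n-1}
-- (element i of Fin n stands for i+1 of [n]); subsets are Subset n.

shift : ∀ {n} → Fin n → ℕ → Fin n
shift {suc n} i j = (toℕ i + j) mod (suc n)

ρ : ∀ {n} → Fin n → Fin n
ρ i = shift i 1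

-- ρ acting elementwise on subsets: j ∈ ρ(X) iff ρ⁻¹(j) = j - 1 ∈ X
ρS : ∀ {n} → Subset n → Subset n
ρS {n} X = tabulate (λ j → lookup X (shift j (n ∸ 1)))

ρS^ : ∀ {n} → ℕ → Subset n → Subset n
ρS^ zero    X = X
ρS^ (suc t) X = ρS (ρS^ t X)

Stable : ∀ {n} → Subset n → Set
Stable {n} U = ∀ (i : Fin n) → (lookup U i ∧ lookup U (ρ i)) ≡ false

arcCount : ∀ {n} → Subset n → Fin n → ℕ → ℕ
arcCount U i m = sum (map (λ j → if lookup U (shift i j) then 1 else 0) (upTo m))

WellSpread : ∀ {n} → Subset n → Set
WellSpread {n} U = ∀ (i j : Fin n) (m : ℕ) → 1 ≤ m → m ≤ n ∸ 1 →
  ∣ arcCount U i m - arcCount U j m ∣ ≤ 1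

-- vertices of Q(n,k): well-spread k-subsets of [n] that are vertices of SG(n,k)
VertexQ : (n k : ℕ) → Subset n → Set
VertexQ n k X = (∣ X ∣ ≡ k) × Stable X × WellSpread X

-- Read a subset X of ℤ/n as the n-periodic 0/1 sequence χ X; being well-spread makes it balanced
-- (windows of equal length differ by at most one). Start the sequence at a point a minimising
-- n·W(a) − a·k, W the prefix sums: then every prefix sum lies on or above the line of slope k/n,
-- and balance together with gcd(n, k) = 1 keeps it strictly below that line plus one. So the m-th
-- prefix sum is ⌈mk/n⌉, the normalised sequence depends on n and k only, and X, Y are rotations
-- of one another. A rotation by 0 < d < n fixing X would make χ X d-periodic, forcing n ∣ dk.
module Submission where

open import Defs
open import Data.Bool using (Bool; true; false; if_then_else_)
open import Data.Fin as Fin using (toℕ)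
open import Data.Fin.Properties using (toℕ-injective; toℕ-fromℕ<; toℕ<n)
open import Data.Fin.Subset using (Subset; ∣_∣)
open import Data.List using (applyUpTo; upTo)
open import Data.List.Extrema.Nat using (argmin; f[argmin]≤f[xs]; argmin-all)
open import Data.List.Membership.Propositional.Properties using (∈-upTo⁺; ∈-upTo⁻)
import Data.List.Relation.Unary.All as All
open import Data.List.Properties using (map-upTo)
open import Data.Nat
open import Data.Nat.Properties
open import Data.Nat.DivMod
open import Data.Nat.Divisibility using (_∣_; divides; ∣⇒≤)
open import Data.Nat.Coprimality using (Coprime; gcd≡1⇒coprime; coprime-divisor)
open import Data.Nat.GCD using (gcd)
open import Data.Nat.ListAction using (sum)
open import Data.Nat.Tactic.RingSolver using (solve-∀)
open import Data.Product using (Σ; _×_; _,_)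
open import Data.Sum using (inj₁; inj₂)
open import Data.Empty using (⊥; ⊥-elim)
open import Data.Vec using ([]; _∷_; lookup; tabulate)
open import Data.Vec.Properties using (lookup∘tabulate; tabulate∘lookup; tabulate-cong)
open import Function using (_∘_)
open import Relation.Binary using (tri<; tri≈; tri>)
open import Relation.Nullary using (¬_)
open import Relation.Binary.PropositionalEquality

-- Window sums

Σ< : (ℕ → ℕ) → ℕ → ℕ
Σ< f m = sum (applyUpTo f m)

Σ<-cong : ∀ {f g} m → (∀ j → f j ≡ g j) → Σ< f m ≡ Σ< g m
Σ<-cong zero    f≗g = refl
Σ<-cong (suc m) f≗g = cong₂ _+_ (f≗g 0) (Σ<-cong m (f≗g ∘ suc))

Σ<-+ : ∀ f m m' → Σ< f (m + m') ≡ Σ< f m + Σ< (λ j → f (m + j)) m'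
Σ<-+ f zero    m' = refl
Σ<-+ f (suc m) m' = trans (cong (f 0 +_) (Σ<-+ (f ∘ suc) m m')) (sym (+-assoc (f 0) _ _))

window : (ℕ → ℕ) → ℕ → ℕ → ℕ
window y i m = Σ< (λ j → y (i + j)) m

window-++ : ∀ y i m m' → window y i (m + m') ≡ window y i m + window y (i + m) m'
window-++ y i m m' = trans (Σ<-+ _ m m')
  (cong (window y i m +_) (Σ<-cong m' λ j → cong y (sym (+-assoc i m j))))

window-∷ : ∀ y i m → window y i (suc m) ≡ y i + window y (suc i) m
window-∷ y i m = cong₂ _+_ (cong y (+-identityʳ i)) (Σ<-cong m λ j → cong y (+-suc i j))

window-∷ʳ : ∀ y i m → window y i (suc m) ≡ window y i m + y (i + m)
window-∷ʳ y i m = begin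
  window y i (suc m)                    ≡⟨ cong (window y i) (+-comm 1 m) ⟩
  window y i (m + 1)                    ≡⟨ window-++ y i m 1 ⟩
  window y i m + (y (i + m + 0) + 0)    ≡⟨ cong (window y i m +_) (trans (+-identityʳ _) (cong y (+-identityʳ _))) ⟩
  window y i m + y (i + m)              ∎
  where open ≡-Reasoning

window-shift : ∀ y a i m → window (λ j → y (a + j)) i m ≡ window y (a + i) m
window-shift y a i m = Σ<-cong m λ j → cong y (sym (+-assoc a i j))

Periodic : ℕ → (ℕ → ℕ) → Set
Periodic p y = ∀ j → y (p + j) ≡ y j

module _ {p : ℕ} {y : ℕ → ℕ} (per : Periodic p y) where

  periodic-* : ∀ c j → y (c * p + j) ≡ y j
  periodic-* zero    j = refl
  periodic-* (suc c) j = trans (cong y (+-assoc p (c * p) j)) (trans (per _) (periodic-* c j))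

  periodic-% : .{{_ : NonZero p}} → ∀ j → y j ≡ y (j % p)
  periodic-% j = trans (cong y (trans (m≡m%n+[m/n]*n j p) (+-comm (j % p) _))) (periodic-* (j / p) (j % p))

  window-+period : ∀ i m → window y (p + i) m ≡ window y i m
  window-+period i m = Σ<-cong m λ j → trans (cong y (+-assoc p i j)) (per (i + j))

  window-repeat : ∀ c i → window y i (c * p) ≡ c * window y i p
  window-repeat zero    i = refl
  window-repeat (suc c) i = begin
    window y i (p + c * p)                    ≡⟨ window-++ y i p (c * p) ⟩
    window y i p + window y (i + p) (c * p)   ≡⟨ cong (λ s → window y i p + window y s (c * p)) (+-comm i p) ⟩
    window y i p + window y (p + i) (c * p)   ≡⟨ cong (window y i p +_) (trans (window-+period i (c * p)) (window-repeat c i)) ⟩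
    window y i p + c * window y i p           ∎
    where open ≡-Reasoning

  window-rotate : ∀ i → window y i p ≡ window y 0 p
  window-rotate zero    = refl
  window-rotate (suc i) = trans (+-cancelˡ-≡ (y i) _ _ (begin
    y i + window y (suc i) p   ≡⟨ window-∷ y i p ⟨
    window y i (suc p)         ≡⟨ window-∷ʳ y i p ⟩
    window y i p + y (i + p)   ≡⟨ cong (window y i p +_) (trans (cong y (+-comm i p)) (per i)) ⟩
    window y i p + y i         ≡⟨ +-comm _ (y i) ⟩
    y i + window y i p         ∎)) (window-rotate i)
    where open ≡-Reasoning

window-two-periods : ∀ {p q y} → Periodic p y → Periodic q y → p * window y 0 q ≡ q * window y 0 p
window-two-periods {p} {q} {y} p-per q-per = begin
  p * window y 0 q   ≡⟨ window-repeat q-per p 0 ⟨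
  window y 0 (p * q) ≡⟨ cong (window y 0) (*-comm p q) ⟩
  window y 0 (q * p) ≡⟨ window-repeat p-per q 0 ⟩
  q * window y 0 p   ∎
  where open ≡-Reasoning

coprime⇒∤* : ∀ {n k m} → Coprime n k → 1 ≤ m → m < n → ¬ n ∣ m * k
coprime⇒∤* {n} {k} {m@(suc _)} n⊥k _ m<n n∣mk =
  <⇒≱ m<n (∣⇒≤ (coprime-divisor n⊥k (subst (n ∣_) (*-comm m k) n∣mk)))

*-next-multiple : ∀ {x n a b} → x ≤ n * a → a < b → x + n ≤ n * b
*-next-multiple {x} {n} {a} {b} x≤na a<b = begin
  x + n      ≤⟨ +-monoˡ-≤ n x≤na ⟩
  n * a + n  ≡⟨ +-comm (n * a) n ⟩
  n + n * a  ≡⟨ *-suc n a ⟨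
  n * suc a  ≤⟨ *-monoʳ-≤ n a<b ⟩
  n * b      ∎
  where open ≤-Reasoning

*-sandwich-unique : ∀ {x n a b} → x ≤ n * a → n * a < x + n → x ≤ n * b → n * b < x + n → a ≡ b
*-sandwich-unique {a = a} {b} lo₁ hi₁ lo₂ hi₂ with <-cmp a b
... | tri< a<b _ _ = ⊥-elim (<⇒≱ hi₂ (*-next-multiple lo₁ a<b))
... | tri≈ _ a≡b _ = a≡b
... | tri> _ _ b<a = ⊥-elim (<⇒≱ hi₁ (*-next-multiple lo₂ b<a))

-- Normalised balanced sequences

Balanced : ℕ → (ℕ → ℕ) → Set
Balanced n y = ∀ i i' m → 1 ≤ m → m < n → window y i m ≤ window y i' m + 1

record Normalised (n k : ℕ) (y : ℕ → ℕ) : Set where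
  field
    periodic   : Periodic n y
    periodSum  : window y 0 n ≡ k
    balanced   : Balanced n y
    aboveSlope : ∀ m → m * k ≤ n * window y 0 m

module _ {n k : ℕ} .{{_ : NonZero n}} (n⊥k : Coprime n k) where

  belowSlope : ∀ {y} → Normalised n k y → ∀ {m} → 1 ≤ m → m < n → n * window y 0 m < m * k + n
  belowSlope {y} N {m} 1≤m m<n = ≰⇒> too-high
    where
    open Normalised N
    -- An overshooting prefix would, by balance and n ∤ mk, put every m-window strictly above
    -- mk/n; n consecutive windows would then exceed the total m·k of m periods.
    too-high : m * k + n ≤ n * window y 0 m → ⊥
    too-high hi = 1+n≰n (*-cancelˡ-≤ n (subst (λ s → n * suc (m * k) ≤ n * s) total (chain n 0)))
      where
      above : ∀ i → suc (m * k) ≤ n * window y i m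
      above i = ≤∧≢⇒< (+-cancelʳ-≤ n _ _ (begin
          m * k + n                ≤⟨ hi ⟩
          n * window y 0 m         ≤⟨ *-monoʳ-≤ n (balanced 0 i m 1≤m m<n) ⟩
          n * (window y i m + 1)   ≡⟨ *-distribˡ-+ n _ 1 ⟩
          n * window y i m + n * 1 ≡⟨ cong (n * window y i m +_) (*-identityʳ n) ⟩
          n * window y i m + n     ∎))
        λ eq → coprime⇒∤* n⊥k 1≤m m<n (divides (window y i m) (trans eq (*-comm n _)))
        where open ≤-Reasoning
      chain : ∀ c i → c * suc (m * k) ≤ n * window y i (c * m)
      chain zero    i = z≤n
      chain (suc c) i = begin
        suc (m * k) + c * suc (m * k)                     ≤⟨ +-mono-≤ (above i) (chain c (i + m)) ⟩
        n * window y i m + n * window y (i + m) (c * m)   ≡⟨ *-distribˡ-+ n _ _ ⟨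
        n * (window y i m + window y (i + m) (c * m))     ≡⟨ cong (n *_) (window-++ y i m (c * m)) ⟨
        n * window y i (m + c * m)                        ∎
        where open ≤-Reasoning
      total : window y 0 (n * m) ≡ m * k
      total = trans (cong (window y 0) (*-comm n m)) (trans (window-repeat periodic m 0) (cong (m *_) periodSum))

  module _ {y y'} (N : Normalised n k y) (N' : Normalised n k y') where
    open Normalised

    prefix-unique : ∀ m → m ≤ n → window y 0 m ≡ window y' 0 m
    prefix-unique zero    _   = refl
    prefix-unique (suc m) m≤n with m≤n⇒m<n∨m≡n m≤n
    ... | inj₁ m<n  = *-sandwich-unique (aboveSlope N (suc m)) (belowSlope N (s≤s z≤n) m<n)
                                        (aboveSlope N' (suc m)) (belowSlope N' (s≤s z≤n) m<n)
    ... | inj₂ refl = trans (periodSum N) (sym (periodSum N'))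

    normalised-unique : ∀ j → y j ≡ y' j
    normalised-unique j = begin
      y j         ≡⟨ periodic-% (periodic N) j ⟩
      y (j % n)   ≡⟨ below-period (j % n) (m%n<n j n) ⟩
      y' (j % n)  ≡⟨ periodic-% (periodic N') j ⟨
      y' j        ∎
      where
      open ≡-Reasoning
      below-period : ∀ j → j < n → y j ≡ y' j
      below-period j j<n = +-cancelˡ-≡ (window y 0 j) _ _ (begin
        window y 0 j + y j    ≡⟨ window-∷ʳ y 0 j ⟨
        window y 0 (suc j)    ≡⟨ prefix-unique (suc j) j<n ⟩
        window y' 0 (suc j)   ≡⟨ window-∷ʳ y' 0 j ⟩
        window y' 0 j + y' j  ≡⟨ cong (_+ y' j) (prefix-unique j (<⇒≤ j<n)) ⟨
        window y 0 j + y' j   ∎)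

module _ {n k : ℕ} .{{_ : NonZero n}} {x : ℕ → ℕ} (per : Periodic n x) (period≡k : window x 0 n ≡ k) where

  window-+periods : ∀ r c → window x 0 (r + c * n) ≡ window x 0 r + c * k
  window-+periods r c = begin
    window x 0 (r + c * n)          ≡⟨ window-++ x 0 r (c * n) ⟩
    window x 0 r + window x r (c * n) ≡⟨ cong (window x 0 r +_) (window-repeat per c r) ⟩
    window x 0 r + c * window x r n ≡⟨ cong (λ s → window x 0 r + c * s) (trans (window-rotate per r) period≡k) ⟩
    window x 0 r + c * k            ∎
    where open ≡-Reasoning

  -- a ≼ J says n·W(a) − a·k ≤ n·W(J) − J·k for the prefix sums W = window x 0,
  -- with both subtractions moved across.
  _≼_ : ℕ → ℕ → Set
  a ≼ J = n * window x 0 a + J * k ≤ n * window x 0 J + a * k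

  ≼-+periods : ∀ {a r} c → a ≼ r → a ≼ (r + c * n)
  ≼-+periods {a} {r} c a≼r = begin
    n * window x 0 a + (r + c * n) * k          ≡⟨ lhs (n * window x 0 a) r c n k ⟩
    (n * window x 0 a + r * k) + n * (c * k)    ≤⟨ +-monoˡ-≤ _ a≼r ⟩
    (n * window x 0 r + a * k) + n * (c * k)    ≡⟨ rhs n (window x 0 r) (c * k) (a * k) ⟩
    n * (window x 0 r + c * k) + a * k          ≡⟨ cong (λ s → n * s + a * k) (window-+periods r c) ⟨
    n * window x 0 (r + c * n) + a * k          ∎
    where
    open ≤-Reasoning
    lhs : ∀ A r c n k → A + (r + c * n) * k ≡ (A + r * k) + n * (c * k)
    lhs = solve-∀
    rhs : ∀ n W C A → (n * W + A) + n * C ≡ n * (W + C) + A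
    rhs = solve-∀

  ≼⇒aboveSlope : ∀ {a} m → a ≼ (a + m) → m * k ≤ n * window x a m
  ≼⇒aboveSlope {a} m a≼a+m = +-cancelˡ-≤ (n * window x 0 a + a * k) _ _ (begin
    (n * window x 0 a + a * k) + m * k          ≡⟨ lhs (n * window x 0 a) a m k ⟩
    n * window x 0 a + (a + m) * k              ≤⟨ a≼a+m ⟩
    n * window x 0 (a + m) + a * k              ≡⟨ cong (λ s → n * s + a * k) (window-++ x 0 a m) ⟩
    n * (window x 0 a + window x a m) + a * k   ≡⟨ rhs n (window x 0 a) (window x a m) (a * k) ⟩
    (n * window x 0 a + a * k) + n * window x a m ∎)
    where
    open ≤-Reasoning
    lhs : ∀ A a m k → (A + a * k) + m * k ≡ A + (a + m) * k
    lhs = solve-∀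
    rhs : ∀ n W V A → n * (W + V) + A ≡ (n * W + A) + n * V
    rhs = solve-∀

  -- n·W(j) − j·k + n·k, kept in ℕ for j ≤ n.
  private
    shiftedDiscrepancy : ℕ → ℕ
    shiftedDiscrepancy j = n * window x 0 j + (n ∸ j) * k

  anchor : ℕ
  anchor = argmin shiftedDiscrepancy 0 (upTo n)

  anchor<n : anchor < n
  anchor<n = argmin-all shiftedDiscrepancy {P = _< n} (>-nonZero⁻¹ n) (All.tabulate ∈-upTo⁻)

  anchor-≼-below-n : ∀ {j} → j < n → anchor ≼ j
  anchor-≼-below-n {j} j<n = +-cancelʳ-≤ (n * k) _ _ (begin
    (n * W a + j * k) + n * k               ≡⟨ cong (λ s → (n * W a + j * k) + s * k) (m+[n∸m]≡n (<⇒≤ anchor<n)) ⟨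
    (n * W a + j * k) + (a + (n ∸ a)) * k   ≡⟨ regroup (n * W a) j a (n ∸ a) k ⟩
    shiftedDiscrepancy a + (j + a) * k       ≤⟨ +-monoˡ-≤ _ a-minimal ⟩
    shiftedDiscrepancy j + (j + a) * k       ≡⟨ regroup′ (n * W j) j a (n ∸ j) k ⟩
    (n * W j + a * k) + (j + (n ∸ j)) * k   ≡⟨ cong (λ s → (n * W j + a * k) + s * k) (m+[n∸m]≡n (<⇒≤ j<n)) ⟩
    (n * W j + a * k) + n * k               ∎)
    where
    open ≤-Reasoning
    a : ℕ
    a = anchor
    W : ℕ → ℕ
    W = window x 0
    a-minimal : shiftedDiscrepancy a ≤ shiftedDiscrepancy j
    a-minimal = All.lookup (f[argmin]≤f[xs] {f = shiftedDiscrepancy} 0 (upTo n)) (∈-upTo⁺ j<n)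
    regroup : ∀ A j a u k → (A + j * k) + (a + u) * k ≡ (A + u * k) + (j + a) * k
    regroup = solve-∀
    regroup′ : ∀ B j a v k → (B + v * k) + (j + a) * k ≡ (B + a * k) + (j + v) * k
    regroup′ = solve-∀

  anchor-≼ : ∀ J → anchor ≼ J
  anchor-≼ J = subst (anchor ≼_) (sym (m≡m%n+[m/n]*n J n)) (≼-+periods {anchor} {J % n} (J / n) (anchor-≼-below-n (m%n<n J n)))

  normalise : Balanced n x → Σ ℕ λ a → a < n × Normalised n k (λ j → x (a + j))
  normalise bal = anchor , anchor<n , record
    { periodic   = λ j → trans (cong x (reorder anchor n j)) (per (anchor + j))
    ; periodSum  = trans (window-rotate per anchor) period≡k
    ; balanced   = λ i i' m 1≤m m<n → subst₂ (λ u v → u ≤ v + 1)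
        (sym (window-shift x anchor i m)) (sym (window-shift x anchor i' m)) (bal (anchor + i) (anchor + i') m 1≤m m<n)
    ; aboveSlope = λ m → ≼⇒aboveSlope m (anchor-≼ (anchor + m))
    }
    where
    reorder : ∀ a n j → a + (n + j) ≡ n + (a + j)
    reorder = solve-∀

-- Subsets of ℤ/n as periodic 0/1 sequences

indicator : Bool → ℕ
indicator b = if b then 1 else 0

indicator-injective : ∀ {b c} → indicator b ≡ indicator c → b ≡ c
indicator-injective {true}  {true}  _ = refl
indicator-injective {false} {false} _ = refl

Σ<-∣∣ : ∀ {L} (V : Subset L) f → (∀ i → f (toℕ i) ≡ indicator (lookup V i)) → Σ< f L ≡ ∣ V ∣
Σ<-∣∣ []          f f≗V = refl
Σ<-∣∣ (true ∷ V)  f f≗V = cong₂ _+_ (f≗V Fin.zero) (Σ<-∣∣ V (f ∘ suc) (f≗V ∘ Fin.suc))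
Σ<-∣∣ (false ∷ V) f f≗V = cong₂ _+_ (f≗V Fin.zero) (Σ<-∣∣ V (f ∘ suc) (f≗V ∘ Fin.suc))

module _ {n' : ℕ} where
  private
    n : ℕ
    n = suc n'

  member : Subset n → ℕ → Bool
  member X j = lookup X (j mod n)

  χ : Subset n → ℕ → ℕ
  χ X j = indicator (member X j)

  toℕ-mod : ∀ a → toℕ (a mod n) ≡ a % n
  toℕ-mod a = toℕ-fromℕ< (m%n<n a n)

  module _ (X : Subset n) where

    member-cong-% : ∀ a b → a % n ≡ b % n → member X a ≡ member X b
    member-cong-% a b a≡b = cong (lookup X) (toℕ-injective (trans (toℕ-mod a) (trans a≡b (sym (toℕ-mod b)))))

    member-%+ : ∀ a b → member X (toℕ (a mod n) + b) ≡ member X (a + b)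
    member-%+ a b = member-cong-% (toℕ (a mod n) + b) (a + b) (begin
      (toℕ (a mod n) + b) % n        ≡⟨ cong (λ r → (r + b) % n) (toℕ-mod a) ⟩
      (a % n + b) % n                ≡⟨ %-distribˡ-+ (a % n) b n ⟩
      (a % n % n + b % n) % n        ≡⟨ cong (λ r → (r + b % n) % n) (m%n%n≡m%n a n) ⟩
      (a % n + b % n) % n            ≡⟨ %-distribˡ-+ a b n ⟨
      (a + b) % n                    ∎)
      where open ≡-Reasoning

    member-toℕ : ∀ i → member X (toℕ i) ≡ lookup X i
    member-toℕ i = cong (lookup X) (toℕ-injective (trans (toℕ-mod (toℕ i)) (m<n⇒m%n≡m (toℕ<n i))))

    member-+n : ∀ j → member X (n + j) ≡ member X j
    member-+n j = member-cong-% (n + j) j (trans (cong (_% n) (+-comm n j)) ([m+n]%n≡m%n j n))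

    χ-periodic : Periodic n (χ X)
    χ-periodic j = cong indicator (member-+n j)

    χ-periodSum : window (χ X) 0 n ≡ ∣ X ∣
    χ-periodSum = Σ<-∣∣ X (χ X) (cong indicator ∘ member-toℕ)

    arcCount≡window : ∀ i m → arcCount X (i mod n) m ≡ window (χ X) i m
    arcCount≡window i m = trans (cong sum (map-upTo _ m)) (Σ<-cong m λ j → cong indicator (member-%+ i j))

    χ-balanced : WellSpread X → Balanced n (χ X)
    χ-balanced ws i i' m 1≤m m<n = subst₂ (λ u v → u ≤ v + 1) (arcCount≡window i m) (arcCount≡window i' m)
      (≤-trans (m≤n+∣m-n∣ _ _) (+-monoʳ-≤ _ (ws (i mod n) (i' mod n) m 1≤m (s≤s⁻¹ m<n))))

  member-ext : ∀ {X Y} → (∀ j → member X j ≡ member Y j) → X ≡ Y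
  member-ext {X} {Y} X≗Y = begin
    X                   ≡⟨ tabulate∘lookup X ⟨
    tabulate (lookup X) ≡⟨ tabulate-cong (λ i → trans (sym (member-toℕ X i)) (trans (X≗Y (toℕ i)) (member-toℕ Y i))) ⟩
    tabulate (lookup Y) ≡⟨ tabulate∘lookup Y ⟩
    Y                   ∎
    where open ≡-Reasoning

  member-ρS : ∀ X j → member (ρS X) j ≡ member X (j + n')
  member-ρS X j = trans (lookup∘tabulate (λ i → lookup X (shift i n')) (j mod n)) (member-%+ X j n')

  -- Rotating by t moves every point forward by t, i.e. back by t·(n − 1) modulo n.
  member-ρS^ : ∀ t X j → member (ρS^ t X) j ≡ member X (j + t * n')
  member-ρS^ zero    X j = cong (member X) (sym (+-identityʳ j))
  member-ρS^ (suc t) X j = trans (member-ρS (ρS^ t X) j)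
    (trans (member-ρS^ t X (j + n')) (cong (member X) (+-assoc j n' (t * n'))))

  member-ρS^-+ : ∀ t X j → member (ρS^ t X) (t + j) ≡ member X j
  member-ρS^-+ t X j = trans (member-ρS^ t X (t + j))
    (member-cong-% X (t + j + t * n') j (trans (cong (_% n) (regroup t j n')) ([m+kn]%n≡m%n j t n)))
    where
    regroup : ∀ t j n' → t + j + t * n' ≡ j + t * suc n'
    regroup = solve-∀

  ρS^-% : ∀ t X → ρS^ (t % n) X ≡ ρS^ t X
  ρS^-% t X = member-ext λ j → begin
    member (ρS^ (t % n) X) j    ≡⟨ member-ρS^ (t % n) X j ⟩
    member X (j + t % n * n')   ≡⟨ member-cong-% X (j + t * n') (j + t % n * n') (same-residue j) ⟨
    member X (j + t * n')       ≡⟨ member-ρS^ t X j ⟨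
    member (ρS^ t X) j          ∎
    where
    open ≡-Reasoning
    regroup : ∀ j r q n' → j + (r + q * suc n') * n' ≡ j + r * n' + q * n' * suc n'
    regroup = solve-∀
    same-residue : ∀ j → (j + t * n') % n ≡ (j + t % n * n') % n
    same-residue j = begin
      (j + t * n') % n                             ≡⟨ cong (λ s → (j + s * n') % n) (m≡m%n+[m/n]*n t n) ⟩
      (j + (t % n + t / n * n) * n') % n           ≡⟨ cong (_% n) (regroup j (t % n) (t / n) n') ⟩
      (j + t % n * n' + t / n * n' * n) % n        ≡⟨ [m+kn]%n≡m%n (j + t % n * n') (t / n * n') n ⟩
      (j + t % n * n') % n                         ∎

  rotation-fixed⇒periodic : ∀ X s d → ρS^ s X ≡ ρS^ (d + s) X → Periodic d (χ X)
  rotation-fixed⇒periodic X s d eq j = cong indicator (begin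
    member X (d + j)                    ≡⟨ member-ρS^-+ s X (d + j) ⟨
    member (ρS^ s X) (s + (d + j))      ≡⟨ cong (λ Z → member Z (s + (d + j))) eq ⟩
    member (ρS^ (d + s) X) (s + (d + j)) ≡⟨ cong (member (ρS^ (d + s) X)) (regroup s d j) ⟩
    member (ρS^ (d + s) X) (d + s + j)  ≡⟨ member-ρS^-+ (d + s) X j ⟩
    member X j                          ∎)
    where
    open ≡-Reasoning
    regroup : ∀ s d j → s + (d + j) ≡ d + s + j
    regroup = solve-∀

  aligned⇒rotation : ∀ {X Y a b} → a ≤ n → b ≤ n → (∀ j → member X (a + j) ≡ member Y (b + j)) →
                     ρS^ (b + (n ∸ a)) X ≡ Y
  aligned⇒rotation {X} {Y} {a} {b} a≤n b≤n X≈Y = member-ext λ j → begin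
    member (ρS^ t X) j                       ≡⟨ member-+n (ρS^ t X) j ⟨
    member (ρS^ t X) (n + j)                 ≡⟨ member-+n (ρS^ t X) (n + j) ⟨
    member (ρS^ t X) (n + (n + j))           ≡⟨ cong (member (ρS^ t X)) (sym (loop j)) ⟩
    member (ρS^ t X) (t + (a + (n ∸ b + j))) ≡⟨ member-ρS^-+ t X (a + (n ∸ b + j)) ⟩
    member X (a + (n ∸ b + j))               ≡⟨ X≈Y (n ∸ b + j) ⟩
    member Y (b + (n ∸ b + j))               ≡⟨ cong (member Y) (trans (sym (+-assoc b (n ∸ b) j)) (cong (_+ j) (m+[n∸m]≡n b≤n))) ⟩
    member Y (n + j)                         ≡⟨ member-+n Y j ⟩
    member Y j                               ∎
    where
    open ≡-Reasoning
    t : ℕ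
    t = b + (n ∸ a)
    regroup : ∀ a b u v j → b + u + (a + (v + j)) ≡ (a + u) + ((b + v) + j)
    regroup = solve-∀
    loop : ∀ j → t + (a + (n ∸ b + j)) ≡ n + (n + j)
    loop j = trans (regroup a b (n ∸ a) (n ∸ b) j)
      (cong₂ (λ p q → p + (q + j)) (m+[n∸m]≡n a≤n) (m+[n∸m]≡n b≤n))

  normalise-χ : ∀ {k} X → ∣ X ∣ ≡ k → WellSpread X → Σ ℕ λ a → a < n × Normalised n k (λ j → χ X (a + j))
  normalise-χ X ∣X∣≡k X-spread = normalise (χ-periodic X) (trans (χ-periodSum X) ∣X∣≡k) (χ-balanced X X-spread)

  module _ {k} (n⊥k : Coprime n k) {X : Subset n} (∣X∣≡k : ∣ X ∣ ≡ k) where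

    no-small-rotation : ∀ {s d} → 1 ≤ d → d < n → ρS^ s X ≢ ρS^ (d + s) X
    no-small-rotation {s} {d} 1≤d d<n eq = coprime⇒∤* n⊥k 1≤d d<n (divides (window (χ X) 0 d) (begin
      d * k                  ≡⟨ cong (d *_) (trans (sym ∣X∣≡k) (sym (χ-periodSum X))) ⟩
      d * window (χ X) 0 n   ≡⟨ window-two-periods {n} {d} (χ-periodic X) (rotation-fixed⇒periodic X s d eq) ⟨
      n * window (χ X) 0 d   ≡⟨ *-comm n _ ⟩
      window (χ X) 0 d * n   ∎))
      where open ≡-Reasoning

    ρS^-injective : ∀ {s t} → s < n → t < n → ρS^ s X ≡ ρS^ t X → s ≡ t
    ρS^-injective {s} {t} s<n t<n eq with <-cmp s t
    ... | tri< s<t _ _ = ⊥-elim (no-small-rotation (m<n⇒0<n∸m s<t) (≤-<-trans (m∸n≤m t s) t<n)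
                            (trans eq (cong (λ r → ρS^ r X) (sym (m∸n+n≡m (<⇒≤ s<t))))))
    ... | tri≈ _ s≡t _ = s≡t
    ... | tri> _ _ t<s = ⊥-elim (no-small-rotation (m<n⇒0<n∸m t<s) (≤-<-trans (m∸n≤m s t) s<n)
                            (trans (sym eq) (cong (λ r → ρS^ r X) (sym (m∸n+n≡m (<⇒≤ t<s))))))

corollary12 : (n k : ℕ) → 1 ≤ k → 2 * k ≤ n → gcd n k ≡ 1 →
    (X Y : Subset n) → VertexQ n k X → VertexQ n k Y →
    Σ ℕ (λ t → (t < n) × (ρS^ t X ≡ Y) × ((s : ℕ) → s < n → ρS^ s X ≡ Y → s ≡ t))
corollary12 zero (suc _) _ () _ _ _ _ _
corollary12 n@(suc _) k _ _ gcd≡1 X Y (∣X∣≡k , _ , X-spread) (∣Y∣≡k , _ , Y-spread) =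
  let n⊥k = gcd≡1⇒coprime gcd≡1
      (a , a<n , X-normal) = normalise-χ X ∣X∣≡k X-spread
      (b , b<n , Y-normal) = normalise-χ Y ∣Y∣≡k Y-spread
      t = b + (n ∸ a)
      X↦Y : ρS^ (t % n) X ≡ Y
      X↦Y = trans (ρS^-% t X) (aligned⇒rotation (<⇒≤ a<n) (<⇒≤ b<n)
              (λ j → indicator-injective (normalised-unique n⊥k X-normal Y-normal j)))
  in t % n , m%n<n t n , X↦Y , λ s s<n ρˢX≡Y →
       ρS^-injective n⊥k ∣X∣≡k s<n (m%n<n t n) (trans ρˢX≡Y (sym X↦Y))
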